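{- Fix integers $n$ and $s$ with $s = 0$ or $s=1$; when $s=0$, assume also that $n \neq \pm 2$. Then for all positive integers $\alpha$ outside a finite set, every solution $\beta$ of the congruence $x^2 + nx + (-1)^s \equiv 0 \pmod{\alpha}$ with $0 < \beta < \alpha$ has the property that the length of the simple continued fraction expansion of $\alpha/\beta$ (chosen according to the convention below) has the same parity as $s$.
   Context: Convention: a rational number $r> 1$ has two simple continued fraction expansions with positive integer quotients $q_0,\dots,q_{m-1}$, one with final quotient $1$ and one without; the expansion is chosen so that its final quotient $q_{m-1}$ equals $1$ if and only if its initial quotient $q_0$ equals $1$. The length of the expansion is the number $m$ of quotients. -}

module Defs where

open import Data.Nat using (ℕ; zero; suc; _+_; _*_; _≤_; _<_)
open import Data.List using (List; []; _∷_; length)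
open import Data.List.Relation.Unary.All using (All)
open import Data.Product using (_×_; _,_)
open import Data.Maybe using (Maybe; just; nothing)
open import Relation.Binary.PropositionalEquality using (_≡_)

-- Numerator and denominator of the finite simple continued fraction
-- [q₀; q₁, …, q_{m-1}] computed by the usual recursion
--   [q] = q/1,  [q; rest] = q + 1/[rest]  i.e. (q*p + r) / p  when [rest] = p/r.
cfEval : List ℕ → ℕ × ℕ
cfEval []       = (0 , 1)   -- never used for genuine expansions (they are nonempty)
cfEval (q ∷ []) = (q , 1)
cfEval (q ∷ qs@(_ ∷ _)) with cfEval qs
... | (p , r) = (q * p + r , p)

headL : List ℕ → Maybe ℕ
headL []      = nothing
headL (q ∷ _) = just q

lastL : List ℕ → Maybe ℕ
lastL []           = nothing
lastL (q ∷ [])     = just q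
lastL (_ ∷ qs@(_ ∷ _)) = lastL qs

IsCFExpansion : ℕ → ℕ → List ℕ → Set
IsCFExpansion a b qs =
  (1 ≤ length qs) × All (λ q → 1 ≤ q) qs ×
  (let (p , r) = cfEval qs in a * r ≡ p * b)

-- The paper's convention: the final quotient equals 1 iff the initial one does.
ConventionCF : List ℕ → Set
ConventionCF qs = (lastL qs ≡ just 1 → headL qs ≡ just 1)
                × (headL qs ≡ just 1 → lastL qs ≡ just 1)

IsConventionalCF : ℕ → ℕ → List ℕ → Set
IsConventionalCF a b qs = IsCFExpansion a b qs × ConventionCF qs

module Submission where

-- Let qs = [q₀; …, q_{m-1}] be the conventional expansion of
-- α/β and let M qs = (A B ; C D) be the product of the matrices (qᵢ 1 ; 1 0).
-- Then A/C = α/β and AD − BC = (−1)^m.  Suppose m has the wrong parity, so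
-- that BC − AD = ε := (−1)^s.  Since BC − AD = ±1 the fraction A/C is in
-- lowest terms, and so is α/β because α ∣ β² + nβ + ε; hence α = A, β = C.
-- The congruence C² + nC + ε ≡ 0 (mod A) together with BC ≡ ε (mod A)
-- gives the "trace condition" B + C + n = tA for an integer t.
-- The continuant matrix of an expansion with first and last quotient ≥ 2
-- satisfies 2D ≤ B, C ≤ A/2 and 2D ≤ C, B ≤ A/2; a short case analysis on t
-- (t ≤ 0, t = 1, t ≥ 2) then bounds A by 4N² + 4N + 6 with N = |n|.
-- By the convention, an expansion either has first and last quotient ≥ 2,
-- or has a single quotient (D = 0, handled directly), or is 1 ∷ mid ∷ʳ 1;
-- in the last case the complementary matrix (the one of α/(α − β)) satisfies
-- the same conditions for −n, so the same bound applies.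

open import Defs

open import Agda.Builtin.FromNat using (Number; fromNat)
open import Data.Unit using (⊤)
import Data.Integer.Literals as ℤ-Literals
import Data.Nat.Literals as ℕ-Literals

open import Data.Nat.Base using (ℕ)
open import Data.Integer.Base using (ℤ)

instance
  ℤ-number : Number ℤ
  ℤ-number = ℤ-Literals.number
  ℕ-number : Number ℕ
  ℕ-number = ℕ-Literals.number

module Continuants where
  open import Data.Nat using (ℕ; _+_; _*_; _≤_; z≤n; s≤s)
  open import Data.Nat.Properties
    using (≤-trans; m≤m+n; +-monoˡ-≤; +-mono-≤; *-monoˡ-≤; *-identityˡ; +-identityʳ)
  open import Data.Nat.Tactic.RingSolver using (solve-∀)
  open import Data.List using (List; []; _∷_; _∷ʳ_)
  open import Data.List.Relation.Unary.All using (All; []; _∷_)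
  open import Data.Product using (_,_)
  open import Relation.Binary.PropositionalEquality

  record Mat : Set where
    constructor mat
    field A B C D : ℕ
  open Mat public

  mat-cong : ∀ {a b c d a′ b′ c′ d′} → a ≡ a′ → b ≡ b′ → c ≡ c′ → d ≡ d′ →
             mat a b c d ≡ mat a′ b′ c′ d′
  mat-cong refl refl refl refl = refl

  -- Left multiplication by (q 1 ; 1 0).
  push : ℕ → Mat → Mat
  push q (mat a b c d) = mat (q * a + c) (q * b + d) a b

  -- Right multiplication by (q 1 ; 1 0).
  append : ℕ → Mat → Mat
  append q (mat a b c d) = mat (q * a + b) a (q * c + d) c

  M : List ℕ → Mat
  M []       = mat 1 0 0 1
  M (q ∷ qs) = push q (M qs)

  cfEval-M : ∀ q qs → cfEval (q ∷ qs) ≡ (A (M (q ∷ qs)) , C (M (q ∷ qs)))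
  cfEval-M q [] = cong (_, 1) (unit-column q)
    where
    unit-column : ∀ q → q ≡ q * 1 + 0
    unit-column = solve-∀
  cfEval-M q (r ∷ rs) with cfEval (r ∷ rs) | cfEval-M r rs
  ... | _ | refl = refl

  -- Matrix multiplication is associative: pushing and appending commute.
  push-append : ∀ p q m → push p (append q m) ≡ append q (push p m)
  push-append p q (mat a b c d) = mat-cong (entry p q a b c d) refl refl refl
    where
    entry : ∀ p q a b c d → p * (q * a + b) + (q * c + d) ≡ q * (p * a + c) + (p * b + d)
    entry = solve-∀

  M-∷ʳ : ∀ xs q → M (xs ∷ʳ q) ≡ append q (M xs)
  M-∷ʳ []       q = mat-cong refl (one q) (sym (one q)) refl
    where
    one : ∀ q → q * 0 + 1 ≡ 1
    one = solve-∀
  M-∷ʳ (x ∷ xs) q = trans (cong (push x) (M-∷ʳ xs q)) (push-append x q (M xs))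

  scaled-≤ : ∀ {h q} u v → h ≤ q → h * u ≤ q * u + v
  scaled-≤ u v h≤q = ≤-trans (*-monoˡ-≤ u h≤q) (m≤m+n _ v)

  A-pos : ∀ qs → All (1 ≤_) qs → 1 ≤ A (M qs)
  A-pos []       []          = s≤s z≤n
  A-pos (q ∷ qs) (q≥1 ∷ pos) =
    ≤-trans (A-pos qs pos) (subst (_≤ A (M (q ∷ qs))) (*-identityˡ a) (scaled-≤ a (C (M qs)) q≥1))
    where
    a : ℕ
    a = A (M qs)

  -- Shape inequalities of the continuant matrix of an expansion with at least
  -- two quotients, the first at least h and the last at least l.
  record Shaped (h l : ℕ) (m : Mat) : Set where
    field
      D-pos  : 1 ≤ D m
      head-C : h * C m ≤ A m
      head-D : h * D m ≤ B m
      last-B : l * B m ≤ A m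
      last-D : l * D m ≤ C m

  shaped : ∀ {h l} q mid z → All (1 ≤_) mid → h ≤ q → l ≤ z → Shaped h l (M (q ∷ mid ∷ʳ z))
  shaped {h} {l} q mid z pos h≤q l≤z = record
    { D-pos  = subst (λ m → 1 ≤ B m) (sym (M-∷ʳ mid z)) (A-pos mid pos)
    ; head-C = scaled-≤ _ _ h≤q
    ; head-D = scaled-≤ _ _ h≤q
    ; last-B = subst (λ m → l * B m ≤ A m) (sym as-append) (scaled-≤ _ _ l≤z)
    ; last-D = subst (λ m → l * D m ≤ C m) (sym as-append) (scaled-≤ _ _ l≤z)
    }
    where
    as-append : M (q ∷ mid ∷ʳ z) ≡ append z (M (q ∷ mid))
    as-append = M-∷ʳ (q ∷ mid) z

  -- For a list 1 ∷ mid ∷ʳ 1 (value α/β) the matrix is star (M mid); its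
  -- complement dual (M mid), with first column (α, α − β), has the same
  -- determinant and the opposite trace condition.
  star : Mat → Mat
  star (mat a b c d) = mat (a + b + c + d) (a + c) (a + b) a

  dual : Mat → Mat
  dual (mat a b c d) = mat (a + b + c + d) (b + d) (c + d) d

  push-append-one : ∀ m → push 1 (append 1 m) ≡ star m
  push-append-one (mat a b c d) =
    mat-cong (corner a b c d) (*-identityˡ-+ a c) (*-identityˡ-+ a b) refl
    where
    corner : ∀ a b c d → 1 * (1 * a + b) + (1 * c + d) ≡ a + b + c + d
    corner = solve-∀
    *-identityˡ-+ : ∀ a b → 1 * a + b ≡ a + b
    *-identityˡ-+ a b = cong (_+ b) (*-identityˡ a)

  M-star : ∀ mid → M (1 ∷ mid ∷ʳ 1) ≡ star (M mid)
  M-star mid = trans (cong (push 1) (M-∷ʳ mid 1)) (push-append-one (M mid))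

  double-≤ : ∀ {x y} → x ≤ y → 2 * x ≤ y + x
  double-≤ {x} {y} x≤y = subst (_≤ y + x) (sym (cong (x +_) (+-identityʳ x))) (+-monoˡ-≤ x x≤y)

  dual-shaped : ∀ {m} → Shaped 1 1 m → Shaped 2 2 (dual m)
  dual-shaped {m} s = record
    { D-pos  = D-pos
    ; head-C = subst (2 * (C m + D m) ≤_) (regroup₁ (A m) (B m) (C m) (D m))
                     (double-≤ (+-mono-≤ (unit head-C) (unit head-D)))
    ; head-D = double-≤ (unit head-D)
    ; last-B = subst (2 * (B m + D m) ≤_) (regroup₂ (A m) (B m) (C m) (D m))
                     (double-≤ (+-mono-≤ (unit last-B) (unit last-D)))
    ; last-D = double-≤ (unit last-D)
    }
    where
    open Shaped s
    unit : ∀ {u v} → 1 * u ≤ v → u ≤ v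
    unit = subst (_≤ _) (*-identityˡ _)
    regroup₁ : ∀ a b c d → a + b + (c + d) ≡ a + b + c + d
    regroup₁ = solve-∀
    regroup₂ : ∀ a b c d → a + c + (b + d) ≡ a + b + c + d
    regroup₂ = solve-∀

module NonNegativity where
  open import Data.Nat as ℕ using (ℕ; _≤_)
  import Data.Nat.Properties as ℕP
  open import Data.Integer using (ℤ; +_; -[1+_]; -_; _+_; _-_; _*_; ∣_∣; 0ℤ; 1ℤ; -1ℤ)
  open import Data.Integer.Properties
    using (pos-+; pos-*; +-injective; m-n≡m⊖n; ⊖-≥; +-inverseʳ; +-identityʳ; *-zeroˡ)
  open import Data.Integer.Tactic.RingSolver using (solve-∀)
  open import Data.Product using (∃; _×_; _,_)
  open import Data.Sum using (_⊎_; inj₁; inj₂)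
  open import Relation.Binary.PropositionalEquality

  NonNeg : ℤ → Set
  NonNeg x = ∃ λ k → x ≡ + k

  infixl 6 _⊕_
  infixl 7 _⊛_

  _⊕_ : ∀ {x y} → NonNeg x → NonNeg y → NonNeg (x + y)
  (k , refl) ⊕ (l , refl) = k ℕ.+ l , sym (pos-+ k l)

  _⊛_ : ∀ {x y} → NonNeg x → NonNeg y → NonNeg (x * y)
  (k , refl) ⊛ (l , refl) = k ℕ.* l , sym (pos-* k l)

  nat : ∀ k → NonNeg (+ k)
  nat k = k , refl

  nonneg-≡ : ∀ {x y} → x ≡ y → NonNeg y → NonNeg x
  nonneg-≡ refl y≥0 = y≥0

  certified : ∀ {x L R} p u → L ≡ R → x ≡ p + (L - R) * u → NonNeg p → NonNeg x
  certified {R = R} p u refl x≡ p≥0 = nonneg-≡ (begin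
    _                ≡⟨ x≡ ⟩
    p + (R - R) * u  ≡⟨ cong (λ e → p + e * u) (+-inverseʳ R) ⟩
    p + 0ℤ * u       ≡⟨ cong (λ e → p + e) (*-zeroˡ u) ⟩
    p + 0ℤ           ≡⟨ +-identityʳ p ⟩
    p                ∎) p≥0
    where open ≡-Reasoning

  sub-add : ∀ x y → x ≡ (x - y) + y
  sub-add = solve-∀

  ≥-nonneg : ∀ {x y} → NonNeg (x - y) → NonNeg y → NonNeg x
  ≥-nonneg {x} {y} x≥y y≥0 = nonneg-≡ (sub-add x y) (x≥y ⊕ y≥0)

  halve : ∀ x → NonNeg (2 * x) → NonNeg x
  halve (+ k)    _       = k , refl
  halve -[1+ k ] (_ , ())

  ≤⇒nonneg : ∀ {m n} → m ≤ n → NonNeg (+ n - + m)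
  ≤⇒nonneg {m} {n} m≤n = n ℕ.∸ m , trans (m-n≡m⊖n n m) (⊖-≥ m≤n)

  scaled⇒nonneg : ∀ {k u v} → k ℕ.* u ≤ v → NonNeg (+ v - + k * + u)
  scaled⇒nonneg {k} {u} {v} ku≤v = subst (λ e → NonNeg (+ v - e)) (pos-* k u) (≤⇒nonneg ku≤v)

  nonneg⇒≤ : ∀ {m n} → NonNeg (+ n - + m) → m ≤ n
  nonneg⇒≤ {m} {n} (k , n-m≡k) = subst (m ≤_) (sym n≡k+m) (ℕP.m≤n+m m k)
    where
    n≡k+m : n ≡ k ℕ.+ m
    n≡k+m = +-injective (trans (sub-add (+ n) (+ m))
                               (trans (cong (_+ + m) n-m≡k) (sym (pos-+ k m))))

  trichotomy : ∀ k → NonNeg (k - 1) ⊎ k ≡ 0ℤ ⊎ NonNeg (- k - 1)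
  trichotomy (+ ℕ.zero)  = inj₂ (inj₁ refl)
  trichotomy (+ ℕ.suc j) = inj₁ (j , refl)
  trichotomy -[1+ j ]    = inj₂ (inj₂ (j , refl))

  Unit : ℤ → Set
  Unit ε = ε ≡ 1ℤ ⊎ ε ≡ -1ℤ

  unit-sandwich : ∀ {ε} x → Unit ε → ε * x * ε ≡ x
  unit-sandwich x (inj₁ refl) = by-ring x
    where
    by-ring : ∀ x → 1ℤ * x * 1ℤ ≡ x
    by-ring = solve-∀
  unit-sandwich x (inj₂ refl) = by-ring x
    where
    by-ring : ∀ x → -1ℤ * x * -1ℤ ≡ x
    by-ring = solve-∀

  unit-abs : ∀ {ε} → Unit ε → ∣ ε ∣ ≡ 1
  unit-abs (inj₁ refl) = refl
  unit-abs (inj₂ refl) = refl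

  unit-≤1 : ∀ {ε} → Unit ε → NonNeg (1ℤ - ε)
  unit-≤1 (inj₁ refl) = nat 0
  unit-≤1 (inj₂ refl) = nat 2

  unit-≥-1 : ∀ {ε} → Unit ε → NonNeg (1ℤ + ε)
  unit-≥-1 (inj₁ refl) = nat 2
  unit-≥-1 (inj₂ refl) = nat 0

  product-unit : ∀ {x y ε} → NonNeg x → NonNeg y → x * y ≡ ε → Unit ε →
                 ε ≡ 1ℤ × x ≡ 1ℤ × y ≡ 1ℤ
  product-unit (k , refl) (l , refl) kl≡ε (inj₁ refl) =
    refl , cong +_ (ℕP.m*n≡1⇒m≡1 k l kl≡1) , cong +_ (ℕP.m*n≡1⇒n≡1 k l kl≡1)
    where
    kl≡1 : k ℕ.* l ≡ 1
    kl≡1 = +-injective (trans (pos-* k l) kl≡ε)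
  product-unit (k , refl) (l , refl) kl≡ε (inj₂ refl) with trans (pos-* k l) kl≡ε
  ... | ()

module Determinants where
  open Continuants
  open NonNegativity
  open import Data.Nat as ℕ using (ℕ; _≤_)
  import Data.Nat.Properties as ℕP
  open import Data.Integer
    using (ℤ; +_; -[1+_]; -_; _+_; _-_; _*_; _^_; ∣_∣; 1ℤ; -1ℤ)
  open import Data.Integer.Properties
    using (pos-+; pos-*; +-injective; abs-*; *-identityʳ; neg-involutive)
  open import Data.Integer.Divisibility using (_∣_)
  open import Data.Integer.Divisibility.Signed using (∣ᵤ⇒∣; divides)
  open import Data.Integer.Tactic.RingSolver using (solve-∀)
  open import Data.List using (List; []; _∷_; length)
  open import Data.Product using (∃; _×_; _,_)
  open import Relation.Binary.PropositionalEquality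
  open ≡-Reasoning

  det : Mat → ℤ
  det m = + A m * + D m - + B m * + C m

  pos-affine : ∀ q a c → + (q ℕ.* a ℕ.+ c) ≡ + q * + a + + c
  pos-affine q a c = trans (pos-+ (q ℕ.* a) c) (cong (_+ + c) (pos-* q a))

  det-push : ∀ q m → det (push q m) ≡ - det m
  det-push q (mat a b c d) = begin
    + (q ℕ.* a ℕ.+ c) * + b - + (q ℕ.* b ℕ.+ d) * + a
      ≡⟨ cong₂ (λ u v → u * + b - v * + a) (pos-affine q a c) (pos-affine q b d) ⟩
    (+ q * + a + + c) * + b - (+ q * + b + + d) * + a
      ≡⟨ expand (+ q) (+ a) (+ b) (+ c) (+ d) ⟩
    - (+ a * + d - + b * + c) ∎
    where
    expand : ∀ q a b c d → (q * a + c) * b - (q * b + d) * a ≡ - (a * d - b * c)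
    expand = solve-∀

  det-M : ∀ qs → det (M qs) ≡ -1ℤ ^ length qs
  det-M []       = refl
  det-M (q ∷ qs) = begin
    det (push q (M qs))     ≡⟨ det-push q (M qs) ⟩
    - det (M qs)            ≡⟨ cong -_ (det-M qs) ⟩
    - (-1ℤ ^ length qs)     ≡⟨ negate (-1ℤ ^ length qs) ⟩
    -1ℤ * -1ℤ ^ length qs   ∎
    where
    negate : ∀ x → - x ≡ -1ℤ * x
    negate = solve-∀

  cross : ∀ {ε} m → det m ≡ - ε → + B m * + C m - + A m * + D m ≡ ε
  cross {ε} m det≡ = begin
    + B m * + C m - + A m * + D m   ≡⟨ flip (+ A m) (+ B m) (+ C m) (+ D m) ⟩
    - det m                         ≡⟨ cong -_ det≡ ⟩
    - - ε                           ≡⟨ neg-involutive ε ⟩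
    ε                               ∎
    where
    flip : ∀ a b c d → b * c - a * d ≡ - (a * d - b * c)
    flip = solve-∀

  cofactor : ℤ → Mat → ℕ → ℕ → ℤ
  cofactor ε m α β = ε * (+ B m * + β - + α * + D m)

  -- Cramer's rule: if αC = Aβ and BC − AD = ε is a unit, then (α, β) is the
  -- multiple K·(A, C) of the first column by the cofactor K.
  common-factor : ∀ {ε} m α β → Unit ε → det m ≡ - ε → α ℕ.* C m ≡ A m ℕ.* β →
                  + α ≡ + A m * cofactor ε m α β × + β ≡ + C m * cofactor ε m α β
  common-factor {ε} m α β unit det≡ value = sym α-column , sym β-column
    where
    a b c d α′ β′ : ℤ
    a = + A m
    b = + B m
    c = + C m
    d = + D m
    α′ = + α
    β′ = + β

    αc≡aβ : α′ * c ≡ a * β′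
    αc≡aβ = trans (sym (pos-* α (C m))) (trans (cong +_ value) (pos-* (A m) β))

    bc-ad : b * c - a * d ≡ ε
    bc-ad = cross m det≡

    α-column : a * (ε * (b * β′ - α′ * d)) ≡ α′
    α-column = begin
      a * (ε * (b * β′ - α′ * d))           ≡⟨ expand ε a b d α′ β′ ⟩
      ε * (b * (a * β′) - α′ * (a * d))     ≡⟨ cong (λ u → ε * (b * u - α′ * (a * d))) (sym αc≡aβ) ⟩
      ε * (b * (α′ * c) - α′ * (a * d))     ≡⟨ collect ε a b c d α′ ⟩
      ε * α′ * (b * c - a * d)              ≡⟨ cong (ε * α′ *_) bc-ad ⟩
      ε * α′ * ε                            ≡⟨ unit-sandwich α′ unit ⟩
      α′                                    ∎
      where
      expand : ∀ ε a b d α β → a * (ε * (b * β - α * d)) ≡ ε * (b * (a * β) - α * (a * d))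
      expand = solve-∀
      collect : ∀ ε a b c d α → ε * (b * (α * c) - α * (a * d)) ≡ ε * α * (b * c - a * d)
      collect = solve-∀

    β-column : c * (ε * (b * β′ - α′ * d)) ≡ β′
    β-column = begin
      c * (ε * (b * β′ - α′ * d))           ≡⟨ expand ε b c d α′ β′ ⟩
      ε * (b * (c * β′) - (α′ * c) * d)     ≡⟨ cong (λ u → ε * (b * (c * β′) - u * d)) αc≡aβ ⟩
      ε * (b * (c * β′) - (a * β′) * d)     ≡⟨ collect ε a b c d β′ ⟩
      ε * β′ * (b * c - a * d)              ≡⟨ cong (ε * β′ *_) bc-ad ⟩
      ε * β′ * ε                            ≡⟨ unit-sandwich β′ unit ⟩
      β′                                    ∎
      where
      expand : ∀ ε b c d α β → c * (ε * (b * β - α * d)) ≡ ε * (b * (c * β) - (α * c) * d)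
      expand = solve-∀
      collect : ∀ ε a b c d β → ε * (b * (c * β) - (a * β) * d) ≡ ε * β * (b * c - a * d)
      collect = solve-∀

  positive-factor : ∀ α a K → 1 ≤ α → + α ≡ + a * K → ∃ λ k → K ≡ + k
  positive-factor α a (+ k) _ _ = k , refl
  positive-factor (ℕ.suc α) ℕ.zero    -[1+ j ] _ ()
  positive-factor (ℕ.suc α) (ℕ.suc a) -[1+ j ] _ ()

  -- By Cramer's rule α = A·K and
  -- β = C·K, so K divides ε = (β² + nβ + ε) − β² − nβ; and K > 0.
  identify : ∀ {n ε α β} m → Unit ε → det m ≡ - ε → 1 ≤ α →
             α ℕ.* C m ≡ A m ℕ.* β → (+ α) ∣ (+ β * + β + n * + β + ε) →
             α ≡ A m × β ≡ C m
  identify {n} {ε} {α} {β} m unit det≡ α≥1 value α∣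
    with ∣ᵤ⇒∣ {+ α} {+ β * + β + n * + β + ε} α∣ | common-factor m α β unit det≡ value
  ... | divides q poly≡ | α≡aK , β≡cK = column α≡aK , column β≡cK
    where
    a c K r : ℤ
    a = + A m
    c = + C m
    K = cofactor ε m α β
    r = q * a - c * c * K - n * c

    ε≡Kr : ε ≡ K * r
    ε≡Kr = sym (begin
      K * (q * a - c * c * K - n * c)               ≡⟨ expand K q a c n ⟩
      q * (a * K) - (c * K) * (c * K) - n * (c * K)  ≡⟨ cong₂ (λ u v → q * u - v * v - n * v) (sym α≡aK) (sym β≡cK) ⟩
      q * + α - + β * + β - n * + β                  ≡⟨ cong (λ u → u - + β * + β - n * + β) (sym poly≡) ⟩
      + β * + β + n * + β + ε - + β * + β - n * + β  ≡⟨ cancel (+ β) n ε ⟩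
      ε                                              ∎)
      where
      expand : ∀ K q a c n → K * (q * a - c * c * K - n * c) ≡ q * (a * K) - (c * K) * (c * K) - n * (c * K)
      expand = solve-∀
      cancel : ∀ β n ε → β * β + n * β + ε - β * β - n * β ≡ ε
      cancel = solve-∀

    K≡1 : K ≡ 1ℤ
    K≡1 with positive-factor α (A m) K α≥1 α≡aK
    ... | k , K≡k = trans K≡k (cong +_ (ℕP.m*n≡1⇒m≡1 k ∣ r ∣ (begin
      k ℕ.* ∣ r ∣      ≡⟨ cong (λ K′ → ∣ K′ ∣ ℕ.* ∣ r ∣) (sym K≡k) ⟩
      ∣ K ∣ ℕ.* ∣ r ∣  ≡⟨ sym (abs-* K r) ⟩
      ∣ K * r ∣        ≡⟨ cong ∣_∣ (sym ε≡Kr) ⟩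
      ∣ ε ∣            ≡⟨ unit-abs unit ⟩
      1                ∎)))

    column : ∀ {x y} → + x ≡ + y * K → x ≡ y
    column {x} {y} x≡yK = +-injective (trans x≡yK (trans (cong (+ y *_) K≡1) (*-identityʳ (+ y))))

  Trace : ℤ → ℤ → Mat → Set
  Trace n t m = + B m + + C m + n ≡ t * + A m

  -- If det m = −ε and A divides C² + nC + ε, then A divides B + C + n:
  -- with C² + nC + ε = qA one may take t = ε((D + q)B − (B + C + n)D).
  trace-condition : ∀ {n ε} m → Unit ε → det m ≡ - ε →
                    (+ A m) ∣ (+ C m * + C m + n * + C m + ε) → ∃ λ t → Trace n t m
  trace-condition {n} {ε} m unit det≡ A∣
    with ∣ᵤ⇒∣ {+ A m} {+ C m * + C m + n * + C m + ε} A∣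
  ... | divides q poly≡ = t , sym (begin
    t * a                                                          ≡⟨ expand ε q a b c d n ⟩
    ε * (b * (a * d) + b * (q * a) - (b + c + n) * (a * d))        ≡⟨ cong₂ (λ u v → ε * (b * u + b * v - (b + c + n) * u)) ad≡ (sym poly≡) ⟩
    ε * (b * (b * c - ε) + b * (c * c + n * c + ε) - (b + c + n) * (b * c - ε))
                                                                   ≡⟨ collect ε b c n ⟩
    ε * (b + c + n) * ε                                            ≡⟨ unit-sandwich (b + c + n) unit ⟩
    b + c + n                                                      ∎)
    where
    a b c d t : ℤ
    a = + A m
    b = + B m
    c = + C m
    d = + D m
    t = ε * ((d + q) * b - (b + c + n) * d)

    ad≡ : a * d ≡ b * c - ε
    ad≡ = begin
      a * d                    ≡⟨ solve-a-d a b c d ⟩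
      b * c - (b * c - a * d)  ≡⟨ cong (λ e → b * c - e) (cross m det≡) ⟩
      b * c - ε                ∎
      where
      solve-a-d : ∀ a b c d → a * d ≡ b * c - (b * c - a * d)
      solve-a-d = solve-∀

    expand : ∀ ε q a b c d n → ε * ((d + q) * b - (b + c + n) * d) * a ≡
             ε * (b * (a * d) + b * (q * a) - (b + c + n) * (a * d))
    expand = solve-∀
    collect : ∀ ε b c n → ε * (b * (b * c - ε) + b * (c * c + n * c + ε) - (b + c + n) * (b * c - ε)) ≡
              ε * (b + c + n) * ε
    collect = solve-∀

  pos-+₄ : ∀ a b c d → + (a ℕ.+ b ℕ.+ c ℕ.+ d) ≡ + a + + b + + c + + d
  pos-+₄ a b c d = trans (pos-+ (a ℕ.+ b ℕ.+ c) d)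
                         (cong (_+ + d) (trans (pos-+ (a ℕ.+ b) c) (cong (_+ + c) (pos-+ a b))))

  det-star : ∀ m → det (star m) ≡ det m
  det-star (mat a b c d) rewrite pos-+₄ a b c d | pos-+ a c | pos-+ a b =
    expand (+ a) (+ b) (+ c) (+ d)
    where
    expand : ∀ a b c d → (a + b + c + d) * a - (a + c) * (a + b) ≡ a * d - b * c
    expand = solve-∀

  det-dual : ∀ m → det (dual m) ≡ det m
  det-dual (mat a b c d) rewrite pos-+₄ a b c d | pos-+ b d | pos-+ c d =
    expand (+ a) (+ b) (+ c) (+ d)
    where
    expand : ∀ a b c d → (a + b + c + d) * d - (b + d) * (c + d) ≡ a * d - b * c
    expand = solve-∀

  -- The complement α − β solves x² − nx + ε ≡ 0; accordingly the trace
  -- condition for star m turns into the one for dual m with −n and 2 − t.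
  trace-complement : ∀ {n t} m → Trace n t (star m) → Trace (- n) (2 - t) (dual m)
  trace-complement {n} {t} (mat a b c d) trace = begin
    + (b ℕ.+ d) + + (c ℕ.+ d) + - n
      ≡⟨ cong₂ (λ u v → u + v + - n) (pos-+ b d) (pos-+ c d) ⟩
    (+ b + + d) + (+ c + + d) + - n
      ≡⟨ regroup (+ a) (+ b) (+ c) (+ d) n ⟩
    2 * S - ((+ a + + c) + (+ a + + b) + n)
      ≡⟨ cong (λ e → 2 * S - e) trace′ ⟩
    2 * S - t * S
      ≡⟨ factor S t ⟩
    (2 - t) * S
      ≡⟨ cong ((2 - t) *_) (sym (pos-+₄ a b c d)) ⟩
    (2 - t) * + (a ℕ.+ b ℕ.+ c ℕ.+ d) ∎
    where
    S : ℤ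
    S = + a + + b + + c + + d
    trace′ : (+ a + + c) + (+ a + + b) + n ≡ t * S
    trace′ = trans (cong₂ (λ u v → u + v + n) (sym (pos-+ a c)) (sym (pos-+ a b)))
                   (trans trace (cong (t *_) (pos-+₄ a b c d)))
    regroup : ∀ a b c d n → (b + d) + (c + d) + - n ≡ 2 * (a + b + c + d) - ((a + c) + (a + b) + n)
    regroup = solve-∀
    factor : ∀ S t → 2 * S - t * S ≡ (2 - t) * S
    factor = solve-∀

module Bounds (n N : ℤ) where
  open NonNegativity
  open import Data.Integer using (ℤ; +_; -_; _+_; _-_; _*_; 0ℤ; 1ℤ)
  open import Data.Integer.Properties using (*-identityˡ; *-zeroˡ)
  open import Data.Integer.Tactic.RingSolver using (solve-∀)
  open import Data.Empty using (⊥-elim)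
  open import Data.Sum using (inj₁; inj₂)
  open import Data.Product using (_,_)
  open import Relation.Nullary using (¬_)
  open import Relation.Binary.PropositionalEquality
  open ≡-Reasoning

  boundℤ : ℤ
  boundℤ = 4 * N * N + 4 * N + 6

  module _ (N≥0 : NonNeg N) (N≥n : NonNeg (N - n)) (N≥-n : NonNeg (N + n)) where

    quadratic : ∀ p q r → NonNeg (+ p * N * N + + q * N + + r)
    quadratic p q r = nat p ⊛ N≥0 ⊛ N≥0 ⊕ nat q ⊛ N≥0 ⊕ nat r

    -- Matrices (a 1 ; 1 0): the trace condition reads 2 + n = t·a, and t ≠ 0
    -- because n ≠ −2.
    small : ∀ a t → NonNeg a → ¬ n ≡ - 2 → 2 + n ≡ t * a → NonNeg (boundℤ - a)
    small a t a≥0 n≢-2 trace with trichotomy t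
    ... | inj₁ t≥1 =
      certified ((4 * N * N + 3 * N + 4) + (N - n) + (t - 1) * a) 1 trace (rearrange N n t a)
                (quadratic 4 3 4 ⊕ N≥n ⊕ t≥1 ⊛ a≥0)
      where
      rearrange : ∀ N n t a → 4 * N * N + 4 * N + 6 - a ≡
                  ((4 * N * N + 3 * N + 4) + (N - n) + (t - 1) * a) + (2 + n - t * a) * 1
      rearrange = solve-∀
    ... | inj₂ (inj₁ t≡0) = ⊥-elim (n≢-2 (begin
      n                ≡⟨ isolate n ⟩
      (2 + n) - 2      ≡⟨ cong (_- 2) trace ⟩
      t * a - 2        ≡⟨ cong (λ e → e * a - 2) t≡0 ⟩
      0ℤ * a - 2       ≡⟨ cong (_- 2) (*-zeroˡ a) ⟩
      - 2              ∎))
      where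
      isolate : ∀ n → n ≡ (2 + n) - 2
      isolate = solve-∀
    ... | inj₂ (inj₂ t≤-1) =
      certified ((4 * N * N + 3 * N + 8) + (N + n) + (- t - 1) * a) (- 1) trace (rearrange N n t a)
                (quadratic 4 3 8 ⊕ N≥-n ⊕ t≤-1 ⊛ a≥0)
      where
      rearrange : ∀ N n t a → 4 * N * N + 4 * N + 6 - a ≡
                  ((4 * N * N + 3 * N + 8) + (N + n) + (- t - 1) * a) + (2 + n - t * a) * (- 1)
      rearrange = solve-∀

    module Shaped-bound
      (ε a b c d t : ℤ) (unit : Unit ε) (n≢2 : ε ≡ 1ℤ → ¬ n ≡ 2)
      (d≥1 : NonNeg (d - 1)) (b≥2d : NonNeg (b - 2 * d)) (c≥2d : NonNeg (c - 2 * d))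
      (a≥2b : NonNeg (a - 2 * b)) (a≥2c : NonNeg (a - 2 * c))
      (bc-ad : b * c - a * d ≡ ε) (trace : b + c + n ≡ t * a)
      where

      d≥0 : NonNeg d
      d≥0 = ≥-nonneg d≥1 (nat 1)

      b≥0 : NonNeg b
      b≥0 = ≥-nonneg b≥2d (nat 2 ⊛ d≥0)

      c≥0 : NonNeg c
      c≥0 = ≥-nonneg c≥2d (nat 2 ⊛ d≥0)

      a≥0 : NonNeg a
      a≥0 = ≥-nonneg a≥2b (nat 2 ⊛ b≥0)

      -- t ≤ 0: then b + c ≤ −n ≤ N, so ad = bc − ε ≤ N² + 1.
      nonpositive : NonNeg (- t) → NonNeg (boundℤ - a)
      nonpositive t≤0 =
        certified ((3 * N * N + 4 * N + 5) + (N - b) * N + b * (N - c) + (1 + ε) + a * (d - 1)) 1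
                  bc-ad (rearrange N a b c d ε) (quadratic 3 4 5 ⊕ N≥b ⊛ N≥0 ⊕ b≥0 ⊛ N≥c ⊕ unit-≥-1 unit ⊕ a≥0 ⊛ d≥1)
        where
        rearrange : ∀ N a b c d ε → 4 * N * N + 4 * N + 6 - a ≡
                    ((3 * N * N + 4 * N + 5) + (N - b) * N + b * (N - c) + (1 + ε) + a * (d - 1)) + (b * c - a * d - ε) * 1
        rearrange = solve-∀
        N≥b : NonNeg (N - b)
        N≥b = certified ((N + n) + (- t) * a + c) (- 1) trace (isolate N n t a b c) (N≥-n ⊕ t≤0 ⊛ a≥0 ⊕ c≥0)
          where
          isolate : ∀ N n t a b c → N - b ≡ ((N + n) + (- t) * a + c) + (b + c + n - t * a) * (- 1)
          isolate = solve-∀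
        N≥c : NonNeg (N - c)
        N≥c = certified ((N + n) + (- t) * a + b) (- 1) trace (isolate N n t a b c) (N≥-n ⊕ t≤0 ⊛ a≥0 ⊕ b≥0)
          where
          isolate : ∀ N n t a b c → N - c ≡ ((N + n) + (- t) * a + b) + (b + c + n - t * a) * (- 1)
          isolate = solve-∀

      -- t ≥ 2: then 2a ≤ t·a = b + c + n ≤ a + N, so a ≤ N.
      large : NonNeg (t - 2) → NonNeg (boundℤ - a)
      large t≥2 = halve (boundℤ - a)
        (certified (2 * (4 * N * N + 3 * N + 6) + 2 * (N - n) + 2 * (t - 2) * a + (a - 2 * b) + (a - 2 * c)) 2
                   trace (rearrange N n t a b c)
                   (nat 2 ⊛ quadratic 4 3 6 ⊕ nat 2 ⊛ N≥n ⊕ nat 2 ⊛ t≥2 ⊛ a≥0 ⊕ a≥2b ⊕ a≥2c))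
        where
        rearrange : ∀ N n t a b c → 2 * (4 * N * N + 4 * N + 6 - a) ≡
                    (2 * (4 * N * N + 3 * N + 6) + 2 * (N - n) + 2 * (t - 2) * a + (a - 2 * b) + (a - 2 * c))
                    + (b + c + n - t * a) * 2
        rearrange = solve-∀

      -- t = 1: write b = 2d + x, c = 2d + y and k = x + y − n, so that
      -- a = k + 2n + 4d and bc − ad = ε becomes xy + kd = ε.
      module Trace-one (t≡1 : t ≡ 1ℤ) where
        x y k : ℤ
        x = b - 2 * d
        y = c - 2 * d
        k = x + y - n

        trace₁ : b + c + n ≡ a
        trace₁ = trans trace (trans (cong (_* a) t≡1) (*-identityˡ a))

        reduced : x * y + k * d ≡ ε
        reduced = begin
          x * y + k * d          ≡⟨ expand n b c d ⟩
          b * c - (b + c + n) * d ≡⟨ cong (λ e → b * c - e * d) trace₁ ⟩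
          b * c - a * d          ≡⟨ bc-ad ⟩
          ε                      ∎
          where
          expand : ∀ n b c d → (b - 2 * d) * (c - 2 * d) + ((b - 2 * d) + (c - 2 * d) - n) * d ≡
                   b * c - (b + c + n) * d
          expand = solve-∀

        -- k ≥ 1: xy + kd = ε ≤ 1 forces d = k = 1.
        positive : NonNeg (k - 1) → NonNeg (boundℤ - a)
        positive k≥1 =
          certified ((1 - k) + 4 * (1 - d) + 2 * (N - n) + (4 * N * N + 2 * N + 1)) 1 trace₁
                    (rearrange N n a b c d) (k≤1 ⊕ nat 4 ⊛ d≤1 ⊕ nat 2 ⊛ N≥n ⊕ quadratic 4 2 1)
          where
          rearrange : ∀ N n a b c d → 4 * N * N + 4 * N + 6 - a ≡
                      ((1 - ((b - 2 * d) + (c - 2 * d) - n)) + 4 * (1 - d) + 2 * (N - n) + (4 * N * N + 2 * N + 1))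
                      + (b + c + n - a) * 1
          rearrange = solve-∀
          d≤1 : NonNeg (1 - d)
          d≤1 = certified ((1 - ε) + x * y + (k - 1) * d) (- 1) reduced (isolate x y k d ε)
                          (unit-≤1 unit ⊕ b≥2d ⊛ c≥2d ⊕ k≥1 ⊛ d≥0)
            where
            isolate : ∀ x y k d ε → 1 - d ≡ ((1 - ε) + x * y + (k - 1) * d) + (x * y + k * d - ε) * (- 1)
            isolate = solve-∀
          k≤1 : NonNeg (1 - k)
          k≤1 = certified ((1 - ε) + x * y + k * (d - 1)) (- 1) reduced (isolate x y k d ε)
                          (unit-≤1 unit ⊕ b≥2d ⊛ c≥2d ⊕ ≥-nonneg {k} k≥1 (nat 1) ⊛ d≥1)
            where
            isolate : ∀ x y k d ε → 1 - k ≡ ((1 - ε) + x * y + k * (d - 1)) + (x * y + k * d - ε) * (- 1)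
            isolate = solve-∀

        -- k = 0: xy = ε forces x = y = 1, hence n = x + y = 2 and ε = 1,
        -- which is excluded.
        xy≡ε : k ≡ 0ℤ → x * y ≡ ε
        xy≡ε k≡0 = begin
          x * y                   ≡⟨ split x y k d ⟩
          (x * y + k * d) - k * d ≡⟨ cong₂ (λ u v → u - v * d) reduced k≡0 ⟩
          ε - 0ℤ * d              ≡⟨ drop ε d ⟩
          ε                       ∎
          where
          split : ∀ x y k d → x * y ≡ (x * y + k * d) - k * d
          split = solve-∀
          drop : ∀ ε d → ε - 0ℤ * d ≡ ε
          drop = solve-∀

        impossible : k ≡ 0ℤ → NonNeg (boundℤ - a)
        impossible k≡0 with product-unit b≥2d c≥2d (xy≡ε k≡0) unit
        ... | ε≡1 , x≡1 , y≡1 = ⊥-elim (n≢2 ε≡1 (begin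
          n                ≡⟨ isolate x y n ⟩
          x + y - k        ≡⟨ cong₂ (λ u v → u + v - k) x≡1 y≡1 ⟩
          1ℤ + 1ℤ - k      ≡⟨ cong (λ e → 1ℤ + 1ℤ - e) k≡0 ⟩
          2                ∎))
          where
          isolate : ∀ x y n → n ≡ x + y - (x + y - n)
          isolate = solve-∀

        -- k ≤ −1: x + y < n, so x, y ≤ N and d ≤ xy + 1 ≤ N² + 1.
        negative : NonNeg (- k - 1) → NonNeg (boundℤ - a)
        negative k≤-1 =
          certified (4 * (N * N + 1 - d) + (- k - 1) + 2 * (N - n) + (2 * N + 3)) 1 trace₁
                    (rearrange N n a b c d) (nat 4 ⊛ d≤N²+1 ⊕ k≤-1 ⊕ nat 2 ⊛ N≥n ⊕ (nat 2 ⊛ N≥0 ⊕ nat 3))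
          where
          rearrange : ∀ N n a b c d → 4 * N * N + 4 * N + 6 - a ≡
                      (4 * (N * N + 1 - d) + (- ((b - 2 * d) + (c - 2 * d) - n) - 1) + 2 * (N - n) + (2 * N + 3))
                      + (b + c + n - a) * 1
          rearrange = solve-∀
          N≥x : NonNeg (N - x)
          N≥x = nonneg-≡ (isolate N n x y) (N≥n ⊕ k≤-1 ⊕ nat 1 ⊕ c≥2d)
            where
            isolate : ∀ N n x y → N - x ≡ (N - n) + (- (x + y - n) - 1) + 1 + y
            isolate = solve-∀
          N≥y : NonNeg (N - y)
          N≥y = nonneg-≡ (isolate N n x y) (N≥n ⊕ k≤-1 ⊕ nat 1 ⊕ b≥2d)
            where
            isolate : ∀ N n x y → N - y ≡ (N - n) + (- (x + y - n) - 1) + 1 + x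
            isolate = solve-∀
          d≤N²+1 : NonNeg (N * N + 1 - d)
          d≤N²+1 = certified ((N - x) * N + x * (N - y) + (1 + ε) + (- k - 1) * d) 1 reduced (isolate N x y k d ε)
                             (N≥x ⊛ N≥0 ⊕ b≥2d ⊛ N≥y ⊕ unit-≥-1 unit ⊕ k≤-1 ⊛ d≥0)
            where
            isolate : ∀ N x y k d ε → N * N + 1 - d ≡
                      ((N - x) * N + x * (N - y) + (1 + ε) + (- k - 1) * d) + (x * y + k * d - ε) * 1
            isolate = solve-∀

        bounded : NonNeg (boundℤ - a)
        bounded with trichotomy k
        ... | inj₁ k≥1         = positive k≥1
        ... | inj₂ (inj₁ k≡0)  = impossible k≡0
        ... | inj₂ (inj₂ k≤-1) = negative k≤-1

      bounded : NonNeg (boundℤ - a)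
      bounded with trichotomy (t - 1)
      ... | inj₁ t≥2         = large (nonneg-≡ (shift t) t≥2)
        where
        shift : ∀ t → t - 2 ≡ t - 1 - 1
        shift = solve-∀
      ... | inj₂ (inj₁ t≡1)  = Trace-one.bounded (trans (shift t) (cong (_+ 1) t≡1))
        where
        shift : ∀ t → t ≡ t - 1 + 1
        shift = solve-∀
      ... | inj₂ (inj₂ t≤0)  = nonpositive (nonneg-≡ (shift t) t≤0)
        where
        shift : ∀ t → - t ≡ - (t - 1) - 1
        shift = solve-∀

module Bounded-expansions where
  open Continuants
  open NonNegativity
  open Determinants
  open import Data.Nat as ℕ using (ℕ; zero; suc; _≤_; z≤n; s≤s)
  import Data.Nat.Properties as ℕP
  open import Data.Integer using (ℤ; +_; -[1+_]; -_; _+_; _-_; _*_; ∣_∣; 0ℤ; 1ℤ)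
  open import Data.Integer.Properties
    using (pos-+; pos-*; +-inverseʳ; n⊖n≡0; neg-involutive; ∣-i∣≡∣i∣)
  open import Data.Integer.Divisibility using (_∣_)
  open import Data.Integer.Tactic.RingSolver using (solve-∀)
  open import Data.List using (List; []; _∷_; _∷ʳ_; initLast; _∷ʳ′_)
  open import Data.List.Relation.Unary.All using (All; []; _∷_)
  open import Data.List.Relation.Unary.All.Properties using (∷ʳ⁻)
  open import Data.Maybe using (just)
  open import Data.Maybe.Properties using (just-injective)
  open import Data.Product using (∃; _×_; _,_; proj₁; proj₂)
  open import Data.Sum using (_⊎_; inj₁; inj₂)
  open import Relation.Nullary using (¬_)
  open import Relation.Binary.PropositionalEquality
  open ≡-Reasoning

  bound : ℕ → ℕ
  bound N = 4 ℕ.* N ℕ.* N ℕ.+ 4 ℕ.* N ℕ.+ 6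

  bound-≤ : ∀ {n} N a → NonNeg (Bounds.boundℤ n (+ N) - + a) → a ≤ bound N
  bound-≤ N a bound-a≥0 = nonneg⇒≤ (subst (λ e → NonNeg (e - + a)) (sym pos-bound) bound-a≥0)
    where
    pos-bound : + bound N ≡ 4 * + N * + N + 4 * + N + 6
    pos-bound = begin
      + (4 ℕ.* N ℕ.* N ℕ.+ 4 ℕ.* N ℕ.+ 6)          ≡⟨ pos-+ (4 ℕ.* N ℕ.* N ℕ.+ 4 ℕ.* N) 6 ⟩
      + (4 ℕ.* N ℕ.* N ℕ.+ 4 ℕ.* N) + 6             ≡⟨ cong (_+ 6) (pos-+ (4 ℕ.* N ℕ.* N) (4 ℕ.* N)) ⟩
      + (4 ℕ.* N ℕ.* N) + + (4 ℕ.* N) + 6           ≡⟨ cong₂ (λ u v → u + v + 6)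
                                                          (trans (pos-* (4 ℕ.* N) N) (cong (_* + N) (pos-* 4 N)))
                                                          (pos-* 4 N) ⟩
      4 * + N * + N + 4 * + N + 6                   ∎

  abs-bounds : ∀ n → NonNeg (+ ∣ n ∣ - n) × NonNeg (+ ∣ n ∣ + n)
  abs-bounds (+ k)    = (0 , +-inverseʳ (+ k)) , nat (k ℕ.+ k)
  abs-bounds -[1+ k ] = nat (suc k ℕ.+ suc k) , (0 , n⊖n≡0 (suc k))

  Admissible : ℤ → ℤ → Set
  Admissible n ε = ε ≡ 1ℤ → ¬ n ≡ 2 × ¬ n ≡ - 2

  admissible-neg : ∀ {n ε} → Admissible n ε → Admissible (- n) ε
  admissible-neg {n} adm ε≡1 =
      (λ -n≡2 → proj₂ (adm ε≡1) (trans (sym (neg-involutive n)) (cong -_ -n≡2)))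
    , (λ -n≡-2 → proj₁ (adm ε≡1) (trans (sym (neg-involutive n)) (cong -_ -n≡-2)))

  bounded-matrix : ∀ {n ε t} m → D m ≡ 0 ⊎ Shaped 2 2 m → Unit ε → Admissible n ε →
                   det m ≡ - ε → Trace n t m → A m ≤ bound ∣ n ∣
  bounded-matrix {n} {ε} {t} m shape unit adm det≡ trace = bound-≤ {n} ∣ n ∣ (A m) (by-shape shape)
    where
    open Bounds n (+ ∣ n ∣)
    N≥n : NonNeg (+ ∣ n ∣ - n)
    N≥n = proj₁ (abs-bounds n)
    N≥-n : NonNeg (+ ∣ n ∣ + n)
    N≥-n = proj₂ (abs-bounds n)

    bc-ad : + B m * + C m - + A m * + D m ≡ ε
    bc-ad = cross m det≡

    -- With D = 0 the relation BC − AD = ε reads BC = ε, so B = C = 1 and ε = 1.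
    by-shape : D m ≡ 0 ⊎ Shaped 2 2 m → NonNeg (boundℤ - + A m)
    by-shape (inj₁ D≡0) with product-unit (nat (B m)) (nat (C m)) BC≡ε unit
      where
      BC≡ε : + B m * + C m ≡ ε
      BC≡ε = begin
        + B m * + C m                    ≡⟨ pad (+ B m * + C m) (+ A m) ⟩
        + B m * + C m - + A m * + 0      ≡⟨ cong (λ d → + B m * + C m - + A m * + d) (sym D≡0) ⟩
        + B m * + C m - + A m * + D m    ≡⟨ bc-ad ⟩
        ε                                ∎
        where
        pad : ∀ x a → x ≡ x - a * 0ℤ
        pad = solve-∀
    ... | ε≡1 , B≡1 , C≡1 =
      small (nat _) N≥n N≥-n (+ A m) t (nat (A m)) (proj₂ (adm ε≡1))
            (trans (cong₂ (λ u v → u + v + n) (sym B≡1) (sym C≡1)) trace)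
    by-shape (inj₂ s) =
      Shaped-bound.bounded (nat _) N≥n N≥-n ε (+ A m) (+ B m) (+ C m) (+ D m) t unit
        (λ ε≡1 → proj₁ (adm ε≡1))
        (≤⇒nonneg D-pos) (scaled⇒nonneg {2} {D m} head-D) (scaled⇒nonneg {2} {D m} last-D)
        (scaled⇒nonneg {2} {B m} last-B) (scaled⇒nonneg {2} {C m} head-C) bc-ad trace
      where open Shaped s

  -- For the matrix star m of 1 ∷ mid ∷ʳ 1 we bound the complementary matrix
  -- dual m instead: same top-left entry, same determinant, parameter −n.
  bounded-complement : ∀ {n ε t} m → D m ≡ 0 ⊎ Shaped 2 2 (dual m) → Unit ε → Admissible n ε →
                       det (star m) ≡ - ε → Trace n t (star m) → A (star m) ≤ bound ∣ n ∣
  bounded-complement {n} {ε} {t} m shape unit adm det≡ trace =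
    subst (λ N → A (star m) ≤ bound N) (∣-i∣≡∣i∣ n)
      (bounded-matrix { - n} {ε} {2 - t} (dual m) shape unit (admissible-neg adm)
        (trans (det-dual m) (trans (sym (det-star m)) det≡)) (trace-complement {n} {t} m trace))

  lastL-∷ʳ : ∀ q mid z → lastL (q ∷ mid ∷ʳ z) ≡ just z
  lastL-∷ʳ q []        z = refl
  lastL-∷ʳ q (x ∷ mid) z = lastL-∷ʳ x mid z

  -- For
  -- mid = [] the value is 2/1; for mid = [u] the complement has D = 0; for
  -- longer mid the complement is shaped with quotients ≥ 2 at both ends.
  bounded-star : ∀ {n ε t} mid → All (1 ≤_) mid → Unit ε → Admissible n ε →
                 det (M (1 ∷ mid ∷ʳ 1)) ≡ - ε → Trace n t (M (1 ∷ mid ∷ʳ 1)) →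
                 A (M (1 ∷ mid ∷ʳ 1)) ≤ bound ∣ n ∣
  bounded-star {n} {ε} {t} mid pos unit adm det≡ trace =
    subst (λ m → A m ≤ bound ∣ n ∣) (sym (M-star mid))
      (by-length mid pos (subst (λ m → det m ≡ - ε) (M-star mid) det≡) (subst (Trace n t) (M-star mid) trace))
    where
    by-length : ∀ mid → All (1 ≤_) mid → det (star (M mid)) ≡ - ε → Trace n t (star (M mid)) →
                A (star (M mid)) ≤ bound ∣ n ∣
    by-length [] _ _ _ = ℕP.≤-trans (s≤s (s≤s z≤n)) (ℕP.m≤n+m 6 _)
    by-length (u ∷ rest) pos det≡ trace with initLast rest
    ... | []          = bounded-complement {n} {ε} {t} (M (u ∷ [])) (inj₁ refl) unit adm det≡ trace
    ... | mid ∷ʳ′ w with pos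
    ...   | u≥1 ∷ pos′ =
      bounded-complement {n} {ε} {t} (M (u ∷ mid ∷ʳ w))
        (inj₂ (dual-shaped (shaped u mid w (proj₁ (∷ʳ⁻ pos′)) u≥1 (proj₂ (∷ʳ⁻ pos′)))))
        unit adm det≡ trace

  bounded-expansion : ∀ {n ε t} q rest → All (1 ≤_) (q ∷ rest) → ConventionCF (q ∷ rest) →
                      Unit ε → Admissible n ε → det (M (q ∷ rest)) ≡ - ε →
                      Trace n t (M (q ∷ rest)) → A (M (q ∷ rest)) ≤ bound ∣ n ∣
  bounded-expansion {n} {ε} {t} q rest pos conv unit adm det≡ trace with initLast rest
  ... | []        = bounded-matrix {n} {ε} {t} (M (q ∷ [])) (inj₁ refl) unit adm det≡ trace
  ... | mid ∷ʳ′ z with q | pos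
  ...   | zero          | () ∷ _
  ...   | suc zero      | _ ∷ pos′ with just-injective (trans (sym (lastL-∷ʳ 1 mid z)) (proj₂ conv refl))
  ...     | refl = bounded-star {n} {ε} {t} mid (proj₁ (∷ʳ⁻ pos′)) unit adm det≡ trace
  bounded-expansion {n} {ε} {t} q rest pos conv unit adm det≡ trace
      | mid ∷ʳ′ z | suc (suc q′) | _ ∷ pos′ =
    bounded-matrix {n} {ε} {t} (M (suc (suc q′) ∷ mid ∷ʳ z))
      (inj₂ (shaped (suc (suc q′)) mid z (proj₁ (∷ʳ⁻ pos′)) (s≤s (s≤s z≤n)) z≥2))
      unit adm det≡ trace
    where
    -- By the convention the last quotient is not 1, since the first is not.
    z≢1 : z ≢ 1
    z≢1 z≡1 with proj₁ conv (trans (lastL-∷ʳ (suc (suc q′)) mid z) (cong just z≡1))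
    ... | ()
    z≥2 : 2 ≤ z
    z≥2 = ℕP.≤∧≢⇒< (proj₂ (∷ʳ⁻ pos′)) (λ 1≡z → z≢1 (sym 1≡z))

  wrong-parity-bounded : ∀ {n ε α β} qs → Unit ε → Admissible n ε → 1 ≤ α →
                         (+ α) ∣ (+ β * + β + n * + β + ε) → IsConventionalCF α β qs →
                         det (M qs) ≡ - ε → α ≤ bound ∣ n ∣
  wrong-parity-bounded [] _ _ _ _ ((() , _) , _) _
  wrong-parity-bounded {n} {ε} {α} {β} (q ∷ rest) unit adm α≥1 α∣ ((_ , pos , value) , conv) det≡ =
    subst (_≤ bound ∣ n ∣) (sym α≡A)
      (bounded-expansion {n} {ε} {proj₁ trace} q rest pos conv unit adm det≡ (proj₂ trace))
    where
    m : Mat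
    m = M (q ∷ rest)
    value′ : α ℕ.* C m ≡ A m ℕ.* β
    value′ = subst (λ p → α ℕ.* proj₂ p ≡ proj₁ p ℕ.* β) (cfEval-M q rest) value
    identified : α ≡ A m × β ≡ C m
    identified = identify {n} m unit det≡ α≥1 value′ α∣
    α≡A : α ≡ A m
    α≡A = proj₁ identified
    A∣ : (+ A m) ∣ (+ C m * + C m + n * + C m + ε)
    A∣ = subst₂ (λ a c → (+ a) ∣ (+ c * + c + n * + c + ε)) α≡A (proj₂ identified) α∣
    trace : ∃ λ t → Trace n t m
    trace = trace-condition {n} m unit det≡ A∣

open import Data.Nat using (ℕ; zero; suc; _≤_; _<_; _%_; s≤s)
open import Data.Nat.DivMod using (m%n<n)
open import Data.Integer using (ℤ; +_; -_; _+_; _*_; _^_; ∣_∣; -1ℤ)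
open import Data.Integer.Divisibility using (_∣_)
open import Data.Integer.Tactic.RingSolver using (solve-∀)
open import Data.List using (List; length; upTo)
open import Data.List.Membership.Propositional using (_∈_)
open import Data.List.Membership.Propositional.Properties using (∈-upTo⁺)
open import Data.Product using (∃; _×_; _,_)
open import Data.Sum using (_⊎_; inj₁; inj₂)
open import Data.Empty using (⊥-elim)
open import Relation.Nullary using (¬_)
open import Relation.Binary.PropositionalEquality using (_≡_; refl; trans)
open NonNegativity using (Unit)
open Determinants using (det-M)
open Bounded-expansions using (bound; Admissible; wrong-parity-bounded)

sign-parity : ∀ k → -1ℤ ^ k ≡ -1ℤ ^ (k % 2)
sign-parity zero          = refl
sign-parity (suc zero)    = refl
sign-parity (suc (suc k)) = trans (square (-1ℤ ^ k)) (sign-parity k)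
  where
  square : ∀ x → -1ℤ * (-1ℤ * x) ≡ x
  square = solve-∀

parity-or-sign : ∀ k s → s ≤ 1 → k % 2 ≡ s ⊎ -1ℤ ^ k ≡ - ((- (+ 1)) ^ s)
parity-or-sign k s s≤1 with k % 2 | m%n<n k 2 | sign-parity k
parity-or-sign k zero       _        | zero         | _               | _    = inj₁ refl
parity-or-sign k zero       _        | suc zero     | _               | sign = inj₂ sign
parity-or-sign k (suc zero) _        | zero         | _               | sign = inj₂ sign
parity-or-sign k (suc zero) _        | suc zero     | _               | _    = inj₁ refl
parity-or-sign k _          _        | suc (suc _)  | s≤s (s≤s ())    | _
parity-or-sign k (suc (suc _)) (s≤s ()) | _         | _               | _

unit-power : ∀ s → s ≤ 1 → Unit ((- (+ 1)) ^ s)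
unit-power zero       _        = inj₁ refl
unit-power (suc zero) _        = inj₂ refl
unit-power (suc (suc _)) (s≤s ())

admissible-power : ∀ n s → s ≤ 1 → (s ≡ 0 → ¬ (n ≡ + 2) × ¬ (n ≡ - (+ 2))) →
                   Admissible n ((- (+ 1)) ^ s)
admissible-power n zero          _        n≢±2 _  = n≢±2 refl
admissible-power n (suc zero)    _        _    ()
admissible-power n (suc (suc _)) (s≤s ()) _

-- The theorem: outside the finite set {0, …, bound |n|} every α has only
-- expansions of parity s, because an expansion of the other parity has
-- det (M qs) = (−1)^length = −(−1)^s and hence α ≤ bound |n|.
lemma2 : (n : ℤ) (s : ℕ) → s ≤ 1 →
  (s ≡ 0 → ¬ (n ≡ + 2) × ¬ (n ≡ - (+ 2))) →
  ∃ λ (E : List ℕ) → ∀ (α : ℕ) → 1 ≤ α → ¬ (α ∈ E) →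
    ∀ (β : ℕ) → 0 < β → β < α →
      (+ α) ∣ ((+ β) * (+ β) + n * (+ β) + (- (+ 1)) ^ s) →
      ∀ (qs : List ℕ) → IsConventionalCF α β qs →
        length qs % 2 ≡ s
lemma2 n s s≤1 n≢±2 = upTo (suc (bound ∣ n ∣)) , parity
  where
  parity : ∀ (α : ℕ) → 1 ≤ α → ¬ (α ∈ upTo (suc (bound ∣ n ∣))) →
           ∀ (β : ℕ) → 0 < β → β < α →
           (+ α) ∣ ((+ β) * (+ β) + n * (+ β) + (- (+ 1)) ^ s) →
           ∀ (qs : List ℕ) → IsConventionalCF α β qs → length qs % 2 ≡ s
  parity α α≥1 α∉E β _ _ α∣ qs expansion with parity-or-sign (length qs) s s≤1
  ... | inj₁ right-parity = right-parity
  ... | inj₂ sign = ⊥-elim (α∉E (∈-upTo⁺ (s≤s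
          (wrong-parity-bounded qs (unit-power s s≤1) (admissible-power n s s≤1 n≢±2) α≥1 α∣ expansion
                                (trans (det-M qs) sign)))))
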